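{- Let $n\ge 1$ and $x$ be integers with $\lfloor n/2\rfloor\le x<n$. Then $f_d(Q_n)\le 2 f_d(Q_x)$.
   Context: $Q_n$ is the $n$-dimensional hypercube: vertices are binary strings of length $n$, adjacent iff they differ in exactly one position ($Q_0$ is a single vertex). The \emph{Explorer–Director game} on a finite connected graph $G$ with starting vertex $v$: a token starts on $v$; in each round, with the token on $u$, the Explorer names a distance $d$ such that some vertex is at distance $d$ from $u$, and the Director moves the token to any vertex at distance exactly $d$ from $u$. Visited vertices are those the token has ever occupied (including $v$). The Explorer maximizes and the Director minimizes the number of visited vertices; the game ends when the Director can keep the token on visited vertices indefinitely; $f_d(G,v)$ is the final number of visited vertices under optimal play. Since $Q_n$ is vertex-transitive, $f_d(Q_n,v)$ does not depend on $v$ and is written $f_d(Q_n)$. -}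

module Defs where

open import Data.Bool using (Bool; true; false)
import Data.Bool.Properties as BoolP
open import Data.Nat using (ℕ; zero; suc; _+_; _≤_; _/_)
open import Data.Vec using (Vec; []; _∷_; replicate)
import Data.Vec.Properties as VecP
open import Data.List using (List; []; _∷_; length)
open import Data.Product using (∃; _×_)
open import Relation.Nullary using (¬_; yes; no)
open import Relation.Binary.PropositionalEquality using (_≡_; _≢_)
open import Relation.Binary.Definitions using (DecidableEquality)

Vertex : ℕ → Set
Vertex n = Vec Bool n

_≟v_ : ∀ {n} → DecidableEquality (Vertex n)
_≟v_ = VecP.≡-dec BoolP._≟_

-- Graph distance in Q_n, which is the Hamming distance
-- (number of positions where the strings differ).
dist : ∀ {n} → Vertex n → Vertex n → ℕ
dist [] [] = 0
dist (a ∷ u) (b ∷ w) with a BoolP.≟ b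
... | yes _ = dist u w
... | no _  = suc (dist u w)

_∈?ᵇ_ : ∀ {n} → Vertex n → List (Vertex n) → Bool
w ∈?ᵇ [] = false
w ∈?ᵇ (s ∷ S) with w ≟v s
... | yes _ = true
... | no _  = w ∈?ᵇ S

visit : ∀ {n} → Vertex n → List (Vertex n) → List (Vertex n)
visit w S with w ∈?ᵇ S
... | true  = S
... | false = w ∷ S

-- Guarantees n k u S : from the position where the token is on u and the
-- (duplicate-free) list of visited vertices is S, the Explorer has a strategy
-- forcing at least k distinct visited vertices in finitely many rounds,
-- whatever the Director does.
data Guarantees (n k : ℕ) : Vertex n → List (Vertex n) → Set where
  done : ∀ {u S} → k ≤ length S → Guarantees n k u S
  step : ∀ {u S} (d : ℕ) →
         ∃ (λ w → dist u w ≡ d) →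
         (∀ w → dist u w ≡ d → Guarantees n k w (visit w S)) →
         Guarantees n k u S

-- Starting vertex 00…0 (Q_n is vertex-transitive).
origin : (n : ℕ) → Vertex n
origin n = replicate n false

CanForce : ℕ → ℕ → Set
CanForce n k = Guarantees n k (origin n) (origin n ∷ [])

IsFd : ℕ → ℕ → Set
IsFd n m = CanForce n m × ¬ CanForce n (suc m)

-- An Explorer strategy on Q_n = Q_(x + y), with y = n ∸ x ≤ x + 1, transfers
-- to Q_x by reading a vertex p of Q_x as a vertex p ++ c…c of Q_n with
-- constant tail.  A distance D ≤ x is named unchanged on Q_x and the
-- Director's answer w is lifted keeping the tail; a larger D is at least y,
-- so D ∸ y is named instead and w is lifted with the tail flipped.  Either
-- way the lift is a legal answer on Q_n, and every vertex visited on Q_n is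
-- one of the two lifts of a vertex visited on Q_x, so forcing 2b + 1
-- vertices on Q_n forces b + 1 on Q_x.
module Submission where

open import Defs
open import Data.Nat using (ℕ; _≤_; _<_; _/_; _*_)
open import Data.Nat using (zero; suc; _+_; _∸_; _%_; z≤n; s≤s; s≤s⁻¹; _≤?_)
open import Data.Nat.Properties
open import Data.Nat.DivMod using (m≡m%n+[m/n]*n; m%n<n)
open import Data.Bool using (Bool; true; false; not)
import Data.Bool.Properties as BoolP
open import Data.Vec using ([]; _∷_; replicate; _++_)
open import Data.List using (List; []; _∷_; length; concatMap)
open import Data.List.Properties using (length-removeAt′)
open import Data.List.Membership.Propositional using (_∈_)
open import Data.List.Relation.Unary.Any as Any using (here; there; _─_)
open import Data.List.Relation.Unary.All as All using (All; []; _∷_)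
open import Data.List.Relation.Unary.Unique.Propositional using (Unique; []; _∷_)
open import Data.List.Relation.Binary.Subset.Propositional using (_⊆_)
open import Data.List.Relation.Binary.Subset.Propositional.Properties using (concatMap⁺)
open import Data.List.Membership.Propositional.Properties using (∈-concatMap⁺)
open import Data.Product using (∃; ∃₂; _×_; _,_)
open import Data.Sum using (_⊎_; inj₁; inj₂)
open import Relation.Nullary using (yes; no; contradiction)
open import Relation.Binary.PropositionalEquality

dist-refl : ∀ {n} (p : Vertex n) → dist p p ≡ 0
dist-refl [] = refl
dist-refl (a ∷ p) with a BoolP.≟ a
... | yes _ = dist-refl p
... | no a≢a = contradiction refl a≢a

dist-≤ : ∀ {n} (p q : Vertex n) → dist p q ≤ n
dist-≤ [] [] = z≤n
dist-≤ (a ∷ p) (b ∷ q) with a BoolP.≟ b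
... | yes _ = m≤n⇒m≤1+n (dist-≤ p q)
... | no _ = s≤s (dist-≤ p q)

dist-++ : ∀ {x y} (p p′ : Vertex x) (q q′ : Vertex y) →
  dist (p ++ q) (p′ ++ q′) ≡ dist p p′ + dist q q′
dist-++ [] [] q q′ = refl
dist-++ (a ∷ p) (b ∷ p′) q q′ with a BoolP.≟ b
... | yes _ = dist-++ p p′ q q′
... | no _ = cong suc (dist-++ p p′ q q′)

dist-cons-not : ∀ {n} a (p q : Vertex n) → dist (a ∷ p) (not a ∷ q) ≡ suc (dist p q)
dist-cons-not a p q with a BoolP.≟ not a
... | yes a≡¬a = contradiction a≡¬a (BoolP.not-¬ refl)
... | no _ = refl

dist-replicate-not : ∀ n c → dist (replicate n c) (replicate n (not c)) ≡ n
dist-replicate-not zero c = refl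
dist-replicate-not (suc n) c =
  trans (dist-cons-not c (replicate n c) _) (cong suc (dist-replicate-not n c))

dist-realised : ∀ {n} (p : Vertex n) d → d ≤ n → ∃ λ w → dist p w ≡ d
dist-realised p zero _ = p , dist-refl p
dist-realised (a ∷ p) (suc d) (s≤s d≤n) with dist-realised p d d≤n
... | w , pw≡d = not a ∷ w , trans (dist-cons-not a p w) (cong suc pw≡d)

∈?ᵇ≡true⇒∈ : ∀ {n} (w : Vertex n) S → w ∈?ᵇ S ≡ true → w ∈ S
∈?ᵇ≡true⇒∈ w (s ∷ S) found with w ≟v s
... | yes w≡s = here w≡s
... | no _ = there (∈?ᵇ≡true⇒∈ w S found)

∈?ᵇ≡false⇒fresh : ∀ {n} (w : Vertex n) S → w ∈?ᵇ S ≡ false → All (w ≢_) S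
∈?ᵇ≡false⇒fresh w [] _ = []
∈?ᵇ≡false⇒fresh w (s ∷ S) missing with w ≟v s
... | no w≢s = w≢s ∷ ∈?ᵇ≡false⇒fresh w S missing

visit-∈ : ∀ {n} (w : Vertex n) S → w ∈ visit w S
visit-∈ w S with w ∈?ᵇ S in found
... | true = ∈?ᵇ≡true⇒∈ w S found
... | false = here refl

visit-⊇ : ∀ {n} (w : Vertex n) S → S ⊆ visit w S
visit-⊇ w S z∈S with w ∈?ᵇ S
... | true = z∈S
... | false = there z∈S

visit-∈⁻ : ∀ {n} (w : Vertex n) S {z} → z ∈ visit w S → z ≡ w ⊎ z ∈ S
visit-∈⁻ w S z∈ with w ∈?ᵇ S
visit-∈⁻ w S z∈S | true = inj₂ z∈S
visit-∈⁻ w S (here z≡w) | false = inj₁ z≡w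
visit-∈⁻ w S (there z∈S) | false = inj₂ z∈S

visit-unique : ∀ {n} (w : Vertex n) S → Unique S → Unique (visit w S)
visit-unique w S unique with w ∈?ᵇ S in found
... | true = unique
... | false = ∈?ᵇ≡false⇒fresh w S found ∷ unique

∈-─⁺ : ∀ {A : Set} {x z : A} {ys : List A} (x∈ys : x ∈ ys) →
  z ∈ ys → z ≢ x → z ∈ (ys ─ x∈ys)
∈-─⁺ (here x≡y) (here z≡y) z≢x = contradiction (trans z≡y (sym x≡y)) z≢x
∈-─⁺ (here _) (there z∈ys) _ = z∈ys
∈-─⁺ (there _) (here z≡y) _ = here z≡y
∈-─⁺ (there x∈ys) (there z∈ys) z≢x = there (∈-─⁺ x∈ys z∈ys z≢x)

length-mono-⊆ : ∀ {A : Set} {xs ys : List A} → Unique xs → xs ⊆ ys →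
  length xs ≤ length ys
length-mono-⊆ {xs = []} [] _ = z≤n
length-mono-⊆ {xs = x ∷ xs} {ys} (x∉xs ∷ unique) xxs⊆ys =
  subst (suc (length xs) ≤_) (sym (length-removeAt′ ys (Any.index x∈ys)))
    (s≤s (length-mono-⊆ unique λ z∈xs →
      ∈-─⁺ x∈ys (xxs⊆ys (there z∈xs)) (≢-sym (All.lookup x∉xs z∈xs))))
  where x∈ys = xxs⊆ys (here refl)

lift : ∀ {x} y → Bool → Vertex x → Vertex (x + y)
lift y c p = p ++ replicate y c

both-lifts : ∀ {x} y → Vertex x → List (Vertex (x + y))
both-lifts y p = lift y false p ∷ lift y true p ∷ []

lifts : ∀ {x} y → List (Vertex x) → List (Vertex (x + y))
lifts y = concatMap (both-lifts y)

length-lifts : ∀ {x} y (S : List (Vertex x)) → length (lifts y S) ≡ 2 * length S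
length-lifts y [] = refl
length-lifts y (p ∷ S) =
  trans (cong (2 +_) (length-lifts y S)) (sym (*-suc 2 (length S)))

lift-∈-lifts : ∀ {x} y c {p : Vertex x} {S} → p ∈ S → lift y c p ∈ lifts y S
lift-∈-lifts y c p∈S = ∈-concatMap⁺ (both-lifts y) (Any.map (λ { refl → lift-∈-both c }) p∈S)
  where
  lift-∈-both : ∀ {p} c → lift y c p ∈ both-lifts y p
  lift-∈-both false = here refl
  lift-∈-both true = there (here refl)

lifted-move : ∀ {x y} → y ≤ suc x → ∀ D → D ≤ x + y → (c : Bool) →
  ∃₂ λ D′ c′ → D′ ≤ x ×
    (∀ (p w : Vertex x) → dist p w ≡ D′ → dist (lift y c p) (lift y c′ w) ≡ D)
lifted-move {x} {y} y≤1+x D D≤x+y c with D ≤? x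
... | yes D≤x = D , c , D≤x , λ p w pw≡D → begin
  dist (lift y c p) (lift y c w)                      ≡⟨ dist-++ p w _ _ ⟩
  dist p w + dist (replicate y c) (replicate y c)     ≡⟨ cong₂ _+_ pw≡D (dist-refl (replicate y c)) ⟩
  D + 0                                               ≡⟨ +-identityʳ D ⟩
  D                                                   ∎
  where open ≡-Reasoning
... | no D≰x = D ∸ y , not c , m≤n+o⇒m∸n≤o D y (subst (D ≤_) (+-comm x y) D≤x+y) ,
  λ p w pw≡D∸y → begin
  dist (lift y c p) (lift y (not c) w)                  ≡⟨ dist-++ p w _ _ ⟩
  dist p w + dist (replicate y c) (replicate y (not c)) ≡⟨ cong₂ _+_ pw≡D∸y (dist-replicate-not y c) ⟩
  D ∸ y + y                                             ≡⟨ m∸n+n≡m (≤-trans y≤1+x (≰⇒> D≰x)) ⟩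
  D                                                     ∎
  where open ≡-Reasoning

visit-lift-⊆ : ∀ {x y S S′} c (w : Vertex x) → S ⊆ lifts y S′ →
  visit (lift y c w) S ⊆ lifts y (visit w S′)
visit-lift-⊆ {y = y} {S} {S′} c w S⊆ z∈ with visit-∈⁻ (lift y c w) S z∈
... | inj₁ refl = lift-∈-lifts y c (visit-∈ w S′)
... | inj₂ z∈S = concatMap⁺ (both-lifts y) (visit-⊇ w S′) (S⊆ z∈S)

Guarantees-mono : ∀ {n k k′ u S} → k′ ≤ k → Guarantees n k u S → Guarantees n k′ u S
Guarantees-mono k′≤k (done k≤∣S∣) = done (≤-trans k′≤k k≤∣S∣)
Guarantees-mono k′≤k (step d realised play) =
  step d realised λ w dw → Guarantees-mono k′≤k (play w dw)

Guarantees-project : ∀ {x y k} → y ≤ suc x → ∀ {c p S S′} →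
  Guarantees (x + y) (suc (2 * k)) (lift y c p) S → Unique S → S ⊆ lifts y S′ →
  Guarantees x (suc k) p S′
Guarantees-project {y = y} {k} _ {S = S} {S′} (done 2k<∣S∣) unique S⊆ =
  done (*-cancelˡ-< 2 k (length S′) (begin-strict
    2 * k                  <⟨ 2k<∣S∣ ⟩
    length S               ≤⟨ length-mono-⊆ unique S⊆ ⟩
    length (lifts y S′)    ≡⟨ length-lifts y S′ ⟩
    2 * length S′          ∎))
  where open ≤-Reasoning
Guarantees-project {y = y} y≤1+x {c} {p} {S} {S′} (step D (w , dw≡D) play) unique S⊆
  with lifted-move y≤1+x D (subst (_≤ _) dw≡D (dist-≤ (lift y c p) w)) c
... | D′ , c′ , D′≤x , lifted-dist = step D′ (dist-realised p D′ D′≤x) λ w′ pw′≡D′ →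
  Guarantees-project y≤1+x {S′ = visit w′ S′} (play (lift y c′ w′) (lifted-dist p w′ pw′≡D′))
    (visit-unique _ S unique) (visit-lift-⊆ {S′ = S′} c′ w′ S⊆)

origin-+ : ∀ x y → origin (x + y) ≡ lift y false (origin x)
origin-+ zero y = refl
origin-+ (suc x) y = cong (false ∷_) (origin-+ x y)

CanForce-half : ∀ {x y k} → y ≤ suc x → CanForce (x + y) (suc (2 * k)) → CanForce x (suc k)
CanForce-half {x} {y} y≤1+x force =
  Guarantees-project y≤1+x {S′ = origin x ∷ []} (subst (λ v → Guarantees (x + y) _ v (v ∷ [])) (origin-+ x y) force)
    ([] ∷ []) λ { (here refl) → lift-∈-lifts y false {S = origin x ∷ []} (here refl) }

n/2≤x⇒n∸x≤1+x : ∀ n x → n / 2 ≤ x → n ∸ x ≤ suc x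
n/2≤x⇒n∸x≤1+x n x n/2≤x = m≤n+o⇒m∸n≤o n x (begin
  n                     ≡⟨ m≡m%n+[m/n]*n n 2 ⟩
  n % 2 + n / 2 * 2     ≤⟨ +-mono-≤ (s≤s⁻¹ (m%n<n n 2)) (*-monoˡ-≤ 2 n/2≤x) ⟩
  1 + x * 2             ≡⟨ cong suc (*-comm x 2) ⟩
  suc (x + (x + 0))     ≡⟨ cong (λ t → suc (x + t)) (+-identityʳ x) ⟩
  suc (x + x)           ≡⟨ +-suc x x ⟨
  x + suc x             ∎)
  where open ≤-Reasoning

lemma4p4 : (n x : ℕ) → 1 ≤ n → n / 2 ≤ x → x < n →
    (a b : ℕ) → IsFd n a → IsFd x b → a ≤ 2 * b
lemma4p4 n x _ n/2≤x x<n a b (force-a , _) (_ , ¬force-1+b) with a ≤? 2 * b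
... | yes a≤2b = a≤2b
... | no a≰2b = contradiction (CanForce-half (n/2≤x⇒n∸x≤1+x n x n/2≤x) force-n) ¬force-1+b
  where
  force-n : CanForce (x + (n ∸ x)) (suc (2 * b))
  force-n = subst (λ m → CanForce m (suc (2 * b))) (sym (m+[n∸m]≡n (<⇒≤ x<n)))
    (Guarantees-mono (≰⇒> a≰2b) force-a)
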